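{- Let $\mathcal{P}$ be a hereditary property of tournaments. If $B(\mathcal{P}) = \infty$, then $\mathcal{P}$ contains arbitrarily large structures of Type 1 or 2; that is, for every $k \in \mathbb{N}$ there is a tournament in $\mathcal{P}$ admitting a $k$-structure of Type 1 or a $k$-structure of Type 2.
   Context: Tournaments are unlabelled; a hereditary property of tournaments is a class closed under isomorphism and induced sub-tournaments. In a tournament $T$, for vertices $u,v$ write $u \curvearrowright v$ if $u \to v$ and there exist $k \geq 0$ and vertices $w_1,\ldots,w_k$ such that, with $C = \{u,w_1,\ldots,w_k,v\}$: (i) $u \to w_i \to v$ for all $i$; (ii) $w_i \to w_j$ for $i<j$; (iii) every $x \notin C$ satisfies: $x \to y$ iff $x \to z$, for all $y,z \in C$. Write $u \sim v$ if $u=v$, $u \curvearrowright v$ or $v \curvearrowright u$; this is an equivalence relation whose classes are the homogeneous blocks of $T$. $B(T)$ is the number of homogeneous blocks of $T$ and $B(\mathcal{P}) = \sup\{B(T): T\in\mathcal{P}\}$. A $k$-structure of Type 1 in $T$: distinct vertices $x_1,\ldots,x_{2k},y$ with $x_i \to x_j$ for $i<j$, and for each $i \in [2k-1]$, $y \to x_i$ if and only if $x_{i+1} \to y$. A $k$-structure of Type 2 in $T$: distinct vertices $x_1,\ldots,x_{2k},y_1,\ldots,y_k$ with $x_i \to x_j$ for $i<j$ and $x_{2i} \to y_i \to x_{2i-1}$ for every $i \in [k]$ (other arcs arbitrary). -}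

module Defs where

open import Data.Nat using (ℕ; _<_; _*_)
open import Data.Fin using (Fin)
open import Data.Bool using (Bool; true; false; not)
open import Data.Product using (Σ; ∃; _×_; _,_)
open import Data.Sum using (_⊎_)
open import Relation.Binary.PropositionalEquality using (_≡_; _≢_)
open import Relation.Nullary using (¬_)
open import Function.Bundles using (_⇔_)

-- A finite tournament on vertex set Fin n: adj u v = true means u → v.
record Tournament : Set where
  field
    n      : ℕ
    adj    : Fin n → Fin n → Bool
    irrefl : ∀ u → adj u u ≡ false
    tourn  : ∀ u v → u ≢ v → adj v u ≡ not (adj u v)

open Tournament public

Arc : (T : Tournament) → Fin (n T) → Fin (n T) → Set
Arc T u v = adj T u v ≡ true

Embedding : Tournament → Tournament → Set
Embedding S T = Σ (Fin (n S) → Fin (n T)) λ f →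
  (∀ i j → f i ≡ f j → i ≡ j) × (∀ i j → Arc S i j ⇔ Arc T (f i) (f j))

Property : Set₁
Property = Tournament → Set

Hereditary : Property → Set
Hereditary P = ∀ S T → Embedding S T → P T → P S

Curve : (T : Tournament) → Fin (n T) → Fin (n T) → Set
Curve T u v = Arc T u v × Σ ℕ λ k → Σ (Fin k → Fin (n T)) λ w →
  let InC : Fin (n T) → Set
      InC x = x ≡ u ⊎ x ≡ v ⊎ ∃ λ i → x ≡ w i
  in (∀ i → Arc T u (w i) × Arc T (w i) v)
   × (∀ i j → Data.Fin._<_ i j → Arc T (w i) (w j))
   × (∀ x → ¬ InC x → ∀ y z → InC y → InC z → (Arc T x y ⇔ Arc T x z))

Sim : (T : Tournament) → Fin (n T) → Fin (n T) → Set
Sim T u v = u ≡ v ⊎ Curve T u v ⊎ Curve T v u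

-- B(T) ≥ m : T has at least m homogeneous blocks, i.e. there are m vertices
-- lying in pairwise distinct ∼-classes.
AtLeastBlocks : Tournament → ℕ → Set
AtLeastBlocks T m = Σ (Fin m → Fin (n T)) λ r → ∀ i j → i ≢ j → ¬ Sim T (r i) (r j)

InfiniteB : Property → Set
InfiniteB P = ∀ m → Σ Tournament λ T → P T × AtLeastBlocks T m

-- k-structure of Type 1 (0-indexed: x 0 … x (2k-1)).
Type1 : (T : Tournament) → ℕ → Set
Type1 T k = Σ (ℕ → Fin (n T)) λ x → Σ (Fin (n T)) λ y →
    (∀ i j → i < 2 * k → j < 2 * k → i ≢ j → x i ≢ x j)
  × (∀ i → i < 2 * k → x i ≢ y)
  × (∀ i j → i < j → j < 2 * k → Arc T (x i) (x j))
  × (∀ i → ℕ.suc i < 2 * k → (Arc T y (x i) ⇔ Arc T (x (ℕ.suc i)) y))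

-- k-structure of Type 2 (0-indexed: x_{2i} → y_i → x_{2i-1} becomes
-- x (2i+1) → y i → x (2i) for i < k).
Type2 : (T : Tournament) → ℕ → Set
Type2 T k = Σ (ℕ → Fin (n T)) λ x → Σ (ℕ → Fin (n T)) λ y →
    (∀ i j → i < 2 * k → j < 2 * k → i ≢ j → x i ≢ x j)
  × (∀ i j → i < k → j < k → i ≢ j → y i ≢ y j)
  × (∀ i j → i < 2 * k → j < k → x i ≢ y j)
  × (∀ i j → i < j → j < 2 * k → Arc T (x i) (x j))
  × (∀ i → i < k → Arc T (x (ℕ.suc (2 * i))) (y i) × Arc T (y i) (x (2 * i)))

-- A long transitive chain c₀ ⟶ c₁ ⟶ ⋯ of pairwise non-equivalent vertices exists by Ramsey's
-- theorem. A vertex y with c (i+1) ⟶ y ⟶ c i (a reversal) closes a cyclic triangle on the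
-- consecutive pair; reversals found in K disjoint windows give K triangles whose bases all point
-- forward and whose apexes avoid each other's bases (a triangle chain). Otherwise some window is
-- quiet. Inside it, c i ↷ c (i+1) fails, so either the vertices between them contain a cyclic
-- triangle or some vertex outside distinguishes them; either way there is a cyclic triangle
-- "at" position i, and every vertex near the window has a level that determines its arcs to the
-- window. Four rounds of Ramsey's theorem on these triangles produce a triangle chain again,
-- built from the triangles themselves or from two of their corners and a window vertex.
-- Finally, among k² chained triangles either k share their apex (Type 1) or k have pairwise
-- distinct apexes (Type 2).

module Submission where

open import Defs
open import Data.Nat using (ℕ; zero; suc; _+_; _*_; _≤_; _<_; z≤n; s≤s; _≤?_; _<?_)
open import Data.Nat.Properties
open import Data.Fin using (Fin; toℕ; fromℕ<)
import Data.Fin as Fin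
import Data.Fin.Properties as Fin
open import Data.Bool using (true; false; not)
open import Data.Bool.Properties using () renaming (_≟_ to _≟ᵇ_)
open import Data.Empty using (⊥-elim)
open import Data.List using (List; []; _∷_; length; map; filter; foldr; reverse; reverseAcc; tabulate; lookup; allFin)
open import Data.List.Properties using (length-map; length-reverse; length-tabulate)
open import Data.List.Membership.Propositional using (_∈_)
open import Data.List.Membership.Propositional.Properties using (∈-allFin; ∈-filter⁺; ∈-lookup)
open import Data.List.Relation.Binary.Sublist.Propositional using (_⊆_; []; _∷_; _∷ʳ_; ⊆-trans)
open import Data.List.Relation.Binary.Sublist.Propositional.Properties
  using (All-resp-⊆; filter-⊆; []⊆-universal)
open import Data.List.Relation.Unary.All as All using (All; []; _∷_)
import Data.List.Relation.Unary.All.Properties as All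
open import Data.List.Relation.Unary.All.Properties using (all-filter)
open import Data.List.Relation.Unary.AllPairs as AllPairs using (AllPairs; []; _∷_)
import Data.List.Relation.Unary.AllPairs.Properties as AllPairs
open import Data.List.Relation.Unary.Any using (Any; here; there; index)
open import Data.List.Relation.Unary.Any.Properties using (lookup-index)
open import Data.Product using (Σ; ∃; _×_; _,_; proj₁; proj₂; uncurry; swap)
open import Data.Sum using (_⊎_; inj₁; inj₂)
open import Function using (id; flip; _∘_)
open import Function.Bundles using (_⇔_; mk⇔)
open import Function.Construct.Composition using (_⇔-∘_)
open import Function.Construct.Identity using (⇔-id)
open import Function.Construct.Symmetry using (⇔-sym)
open import Relation.Binary.Definitions using (tri<; tri≈; tri>)
open import Relation.Binary.PropositionalEquality using (_≡_; _≢_; refl; sym; trans; cong; subst; ≢-sym)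
open import Relation.Nullary using (¬_; Dec; yes; no; contradiction)
open import Relation.Nullary.Decidable using (_×-dec_; _⊎-dec_; decidable-stable)
open import Relation.Unary.Properties using (∁?)

module _ {A : Set} where

  AllPairs-resp-⊆ : ∀ {R : A → A → Set} {xs ys} → xs ⊆ ys → AllPairs R ys → AllPairs R xs
  AllPairs-resp-⊆ []        []         = []
  AllPairs-resp-⊆ (_ ∷ʳ σ)  (_ ∷ rys)  = AllPairs-resp-⊆ σ rys
  AllPairs-resp-⊆ (refl ∷ σ) (ry ∷ rys) = All-resp-⊆ σ ry ∷ AllPairs-resp-⊆ σ rys

  AllPairs-reverseAcc : ∀ {R : A → A → Set} {acc xs} → AllPairs R acc → AllPairs (flip R) xs →
                        All (λ x → All (R x) acc) xs → AllPairs R (reverseAcc acc xs)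
  AllPairs-reverseAcc racc []           []           = racc
  AllPairs-reverseAcc racc (rx ∷ rxs) (xacc ∷ xsacc) =
    AllPairs-reverseAcc (xacc ∷ racc) rxs (All.zipWith (uncurry _∷_) (rx , xsacc))

  AllPairs-reverse : ∀ {R : A → A → Set} {xs} → AllPairs (flip R) xs → AllPairs R (reverse xs)
  AllPairs-reverse {xs = xs} rxs = AllPairs-reverseAcc [] rxs (All.universal (λ _ → []) xs)

  length-filter-∁ : ∀ {P : A → Set} (P? : ∀ a → Dec (P a)) xs →
                    length (filter P? xs) + length (filter (∁? P?) xs) ≡ length xs
  length-filter-∁ P? [] = refl
  length-filter-∁ P? (x ∷ xs) with P? x
  ... | yes _ = cong suc (length-filter-∁ P? xs)
  ... | no _  = trans (+-suc _ _) (cong suc (length-filter-∁ P? xs))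

  pairs : List A → List (A × A)
  pairs (a ∷ b ∷ xs) = (a , b) ∷ pairs xs
  pairs _            = []

  length-pairs : ∀ m (xs : List A) → m + m ≤ length xs → m ≤ length (pairs xs)
  length-pairs zero    xs           _ = z≤n
  length-pairs (suc m) (a ∷ b ∷ xs) (s≤s big) =
    s≤s (length-pairs m xs (≤-pred (subst (_≤ suc (length xs)) (+-suc m m) big)))
  length-pairs (suc m) (a ∷ [])     (s≤s big) with () ← subst (_≤ 0) (+-suc m m) big

  All-pairs : ∀ {R : A → A → Set} {xs} → AllPairs R xs → All (uncurry R) (pairs xs)
  All-pairs {xs = []}         _                = []
  All-pairs {xs = _ ∷ []}     _                = []
  All-pairs {xs = _ ∷ _ ∷ _} ((rab ∷ _) ∷ _ ∷ rxs) = rab ∷ All-pairs rxs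

  Across : (A → A → Set) → A × A → A × A → Set
  Across R (a , b) (c , d) = R a c × R a d × R b c × R b d

  AllPairs-pairs : ∀ {R : A → A → Set} {xs} → AllPairs R xs → AllPairs (Across R) (pairs xs)
  AllPairs-pairs {xs = []}         _                   = []
  AllPairs-pairs {xs = _ ∷ []}     _                   = []
  AllPairs-pairs {R = R} {xs = a ∷ b ∷ _} ((_ ∷ ra) ∷ rb ∷ rxs) = across ra rb ∷ AllPairs-pairs rxs
    where
      across : ∀ {ys} → All (R a) ys → All (R b) ys → All (Across R (a , b)) (pairs ys)
      across {[]}         _ _                                = []
      across {_ ∷ []}     _ _                                = []
      across {_ ∷ _ ∷ _} (rac ∷ rad ∷ ra) (rbc ∷ rbd ∷ rb) = (rac , rad , rbc , rbd) ∷ across ra rb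

  nth : A → List A → ℕ → A
  nth d []       _       = d
  nth d (x ∷ xs) zero    = x
  nth d (x ∷ xs) (suc i) = nth d xs i

  nth-All : ∀ {P : A → Set} d {xs} → All P xs → ∀ {i} → i < length xs → P (nth d xs i)
  nth-All d (px ∷ _)   {zero}  _         = px
  nth-All d (_  ∷ pxs) {suc i} (s≤s i<n) = nth-All d pxs i<n

  nth-AllPairs : ∀ {R : A → A → Set} d {xs} → AllPairs R xs →
                 ∀ {i j} → i < j → j < length xs → R (nth d xs i) (nth d xs j)
  nth-AllPairs d (rx ∷ _)   {zero}  {suc j} _         (s≤s j<n) = nth-All d rx j<n
  nth-AllPairs d (_  ∷ rxs) {suc i} {suc j} (s≤s i<j) (s≤s j<n) = nth-AllPairs d rxs i<j j<n

  AllPairs-lookup : ∀ {R : A → A → Set} {xs} → AllPairs R xs →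
                    ∀ {i j} → i Fin.< j → R (lookup xs i) (lookup xs j)
  AllPairs-lookup (rx ∷ _)   {Fin.zero}  {Fin.suc j} _         = All.lookup rx (∈-lookup j)
  AllPairs-lookup (_ ∷ rxs) {Fin.suc i} {Fin.suc j} (s≤s i<j) = AllPairs-lookup rxs i<j

  ordered⇒distinct : ∀ {R : A → A → Set} → (∀ {a b} → R a b → a ≢ b) → (f : ℕ → A) → ∀ m →
                     (∀ {i j} → i < j → j < m → R (f i) (f j)) →
                     ∀ i j → i < m → j < m → i ≢ j → f i ≢ f j
  ordered⇒distinct R⇒≢ f m ordered i j i<m j<m i≢j with <-cmp i j
  ... | tri< i<j _ _ = R⇒≢ (ordered i<j j<m)
  ... | tri≈ _ i≡j _ = contradiction i≡j i≢j
  ... | tri> _ _ j<i = ≢-sym (R⇒≢ (ordered j<i i<m))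

-- Ramsey's theorem and the pigeonhole principle

module _ {A : Set} where

  HomogeneousSublist : (A → A → Set) → ℕ → List A → Set
  HomogeneousSublist R s xs = Σ (List A) λ ys → ys ⊆ xs × s ≤ length ys × AllPairs R ys

  HomogeneousSublist-resp-⊆ : ∀ {R s xs ys} → xs ⊆ ys → HomogeneousSublist R s xs → HomogeneousSublist R s ys
  HomogeneousSublist-resp-⊆ σ (zs , τ , len , rzs) = zs , ⊆-trans τ σ , len , rzs

  HomogeneousSublist-∷ : ∀ {R : A → A → Set} {s} x {P : A → Set} (P? : ∀ a → Dec (P a)) xs →
                         (∀ {a} → P a → R x a) →
                         HomogeneousSublist R s (filter P? xs) → HomogeneousSublist R (suc s) (x ∷ xs)
  HomogeneousSublist-∷ x P? xs P⇒R (ys , τ , len , rys) =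
    x ∷ ys , refl ∷ ⊆-trans τ (filter-⊆ P? xs) , s≤s len ,
    All.map P⇒R (All-resp-⊆ τ (all-filter P? xs)) ∷ rys

ramseyNumber : ℕ → ℕ → ℕ
ramseyNumber zero    t       = 0
ramseyNumber (suc s) zero    = 0
ramseyNumber (suc s) (suc t) = suc (ramseyNumber s (suc t) + ramseyNumber (suc s) t)

ramsey : ∀ {A : Set} {R : A → A → Set} → (∀ a b → Dec (R a b)) → ∀ s t (xs : List A) →
         ramseyNumber s t ≤ length xs →
         HomogeneousSublist R s xs ⊎ HomogeneousSublist (λ a b → ¬ R a b) t xs
ramsey R? zero    t       xs _ = inj₁ ([] , []⊆-universal xs , z≤n , [])
ramsey R? (suc s) zero    xs _ = inj₂ ([] , []⊆-universal xs , z≤n , [])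
ramsey R? (suc s) (suc t) (x ∷ xs) (s≤s big)
  with ramseyNumber s (suc t) ≤? length (filter (R? x) xs)
... | yes bigR with ramsey R? s (suc t) (filter (R? x) xs) bigR
...   | inj₁ hom = inj₁ (HomogeneousSublist-∷ x (R? x) xs id hom)
...   | inj₂ hom = inj₂ (HomogeneousSublist-resp-⊆ (x ∷ʳ filter-⊆ (R? x) xs) hom)
ramsey R? (suc s) (suc t) (x ∷ xs) (s≤s big)
    | no smallR with ramsey R? (suc s) t (filter (∁? (R? x)) xs) bigNotR
  where
    bigNotR : ramseyNumber (suc s) t ≤ length (filter (∁? (R? x)) xs)
    bigNotR = +-cancelˡ-≤ (ramseyNumber s (suc t)) _ _ (begin
      ramseyNumber s (suc t) + ramseyNumber (suc s) t    ≤⟨ big ⟩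
      length xs                                          ≡⟨ sym (length-filter-∁ (R? x) xs) ⟩
      length (filter (R? x) xs) + length (filter (∁? (R? x)) xs)
        ≤⟨ +-monoˡ-≤ _ (<⇒≤ (≰⇒> smallR)) ⟩
      ramseyNumber s (suc t) + length (filter (∁? (R? x)) xs) ∎)
      where open ≤-Reasoning
... | inj₁ hom = inj₁ (HomogeneousSublist-resp-⊆ (x ∷ʳ filter-⊆ (∁? (R? x)) xs) hom)
... | inj₂ hom = inj₂ (HomogeneousSublist-∷ x (∁? (R? x)) xs id hom)

module _ {A : Set} where

  PairwiseList : (A → A → Set) → ℕ → Set
  PairwiseList R s = Σ (List A) λ ys → s ≤ length ys × AllPairs R ys

  ramsey-refine : ∀ {R Q : A → A → Set} → (∀ a b → Dec (Q a b)) → ∀ s t {xs} →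
                  ramseyNumber s t ≤ length xs → AllPairs R xs →
                  PairwiseList (λ a b → R a b × Q a b) s ⊎ PairwiseList (λ a b → R a b × ¬ Q a b) t
  ramsey-refine Q? s t {xs} big rxs with ramsey Q? s t xs big
  ... | inj₁ (ys , σ , len , qys) = inj₁ (ys , len , AllPairs.zip (AllPairs-resp-⊆ σ rxs , qys))
  ... | inj₂ (ys , σ , len , qys) = inj₂ (ys , len , AllPairs.zip (AllPairs-resp-⊆ σ rxs , qys))

ramseyTower : ℕ → ℕ → ℕ
ramseyTower zero    m = m
ramseyTower (suc r) m = ramseyNumber (ramseyTower r m) m

module _ {A C : Set} (key : A → C) (_≟_ : ∀ (c d : C) → Dec (c ≡ d)) where

  ConstantKeySublist : ℕ → List A → Set
  ConstantKeySublist s xs = Σ (List A) λ ys → ys ⊆ xs × s ≤ length ys × Σ C λ c → All (λ a → key a ≡ c) ys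

  private
    sameKey? : ∀ x a → Dec (key a ≡ key x)
    sameKey? x a = key a ≟ key x

  constantKey⊎distinctKeys : ∀ k j (xs : List A) → j * suc k ≤ length xs →
    ConstantKeySublist (suc k) xs ⊎ HomogeneousSublist (λ a b → key a ≢ key b) j xs
  constantKey⊎distinctKeys k zero xs _ = inj₂ ([] , []⊆-universal xs , z≤n , [])
  constantKey⊎distinctKeys k (suc j) (x ∷ xs) (s≤s big) with suc k ≤? suc (length (filter (sameKey? x) xs))
  ... | yes bigSame = inj₁ (x ∷ filter (sameKey? x) xs , refl ∷ filter-⊆ (sameKey? x) xs , bigSame ,
                            key x , refl ∷ all-filter (sameKey? x) xs)
  ... | no smallSame with constantKey⊎distinctKeys k j (filter (∁? (sameKey? x)) xs) bigOther
    where
      bigOther : j * suc k ≤ length (filter (∁? (sameKey? x)) xs)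
      bigOther = +-cancelˡ-≤ k _ _ (begin
        k + j * suc k                                        ≤⟨ big ⟩
        length xs                                            ≡⟨ sym (length-filter-∁ (sameKey? x) xs) ⟩
        length (filter (sameKey? x) xs) + length (filter (∁? (sameKey? x)) xs)
          ≤⟨ +-monoˡ-≤ _ (<⇒≤ (≤-pred (≰⇒> smallSame))) ⟩
        k + length (filter (∁? (sameKey? x)) xs)             ∎)
        where open ≤-Reasoning
  ... | inj₁ (ys , τ , len , c , same) = inj₁ (ys , x ∷ʳ ⊆-trans τ (filter-⊆ _ xs) , len , c , same)
  ... | inj₂ hom = inj₂ (HomogeneousSublist-∷ x (∁? (sameKey? x)) xs (λ ne e → ne (sym e)) hom)

module InsertionSort {A : Set} (_≟_ : ∀ (a b : A) → Dec (a ≡ b))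
                     {_<_ : A → A → Set} (_<?_ : ∀ a b → Dec (a < b)) where

  insert : A → List A → List A
  insert z [] = z ∷ []
  insert z (a ∷ as) with z ≟ a
  ... | yes _ = a ∷ as
  ... | no _ with z <? a
  ...   | yes _ = z ∷ a ∷ as
  ...   | no _  = a ∷ insert z as

  ∈-insert⁻ : ∀ {x} z as → x ∈ insert z as → x ≡ z ⊎ x ∈ as
  ∈-insert⁻ z [] (here x≡z) = inj₁ x≡z
  ∈-insert⁻ z (a ∷ as) x∈ with z ≟ a
  ... | yes _ = inj₂ x∈
  ... | no _ with z <? a | x∈
  ...   | yes _ | here x≡z   = inj₁ x≡z
  ...   | yes _ | there x∈as = inj₂ x∈as
  ...   | no _  | here x≡a   = inj₂ (here x≡a)
  ...   | no _  | there x∈′  with ∈-insert⁻ z as x∈′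
  ...     | inj₁ x≡z  = inj₁ x≡z
  ...     | inj₂ x∈as = inj₂ (there x∈as)

  ∈-insert⁺ˡ : ∀ z as → z ∈ insert z as
  ∈-insert⁺ˡ z [] = here refl
  ∈-insert⁺ˡ z (a ∷ as) with z ≟ a
  ... | yes z≡a = here z≡a
  ... | no _ with z <? a
  ...   | yes _ = here refl
  ...   | no _  = there (∈-insert⁺ˡ z as)

  ∈-insert⁺ʳ : ∀ {x} z as → x ∈ as → x ∈ insert z as
  ∈-insert⁺ʳ z (a ∷ as) x∈ with z ≟ a
  ... | yes _ = x∈
  ... | no _ with z <? a | x∈
  ...   | yes _ | _          = there x∈
  ...   | no _  | here x≡a   = here x≡a
  ...   | no _  | there x∈as = there (∈-insert⁺ʳ z as x∈as)

  sort : List A → List A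
  sort = foldr insert []

  ∈-sort : ∀ {x} xs → x ∈ xs → x ∈ sort xs
  ∈-sort (x ∷ xs) (here refl) = ∈-insert⁺ˡ x (sort xs)
  ∈-sort (y ∷ xs) (there x∈)  = ∈-insert⁺ʳ y (sort xs) (∈-sort xs x∈)

  module _ (Q : A → Set)
           (<-asym : ∀ {a b} → a < b → ¬ b < a)
           (<-connex : ∀ {a b} → a ≢ b → ¬ a < b → b < a)
           (acyclic : ∀ {a b c} → Q a → Q b → Q c → a < b → b < c → ¬ c < a) where

    All-insert : ∀ {z as} → Q z → All Q as → All Q (insert z as)
    All-insert {z} {as} qz qas = All.tabulate λ x∈ → case (∈-insert⁻ z as x∈)
      where
        case : ∀ {x} → x ≡ z ⊎ x ∈ as → Q x
        case (inj₁ refl) = qz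
        case (inj₂ x∈as) = All.lookup qas x∈as

    insert-sorted : ∀ {z as} → Q z → All Q as → AllPairs _<_ as → AllPairs _<_ (insert z as)
    insert-sorted {z} {[]} _ _ _ = [] ∷ []
    insert-sorted {z} {a ∷ as} qz (qa ∷ qas) (a<as ∷ sorted) with z ≟ a
    ... | yes _ = a<as ∷ sorted
    ... | no z≢a with z <? a
    ...   | yes z<a = All.tabulate z< ∷ a<as ∷ sorted
      where
        z< : ∀ {b} → b ∈ a ∷ as → z < b
        z< (here refl) = z<a
        z< {b} (there b∈as) with z <? b
        ... | yes z<b = z<b
        ... | no z≮b = contradiction (<-connex z≢b z≮b) (acyclic qz qa (All.lookup qas b∈as) z<a a<b)
          where
            a<b : a < b
            a<b = All.lookup a<as b∈as
            z≢b : z ≢ b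
            z≢b refl = <-asym z<a a<b
    ...   | no z≮a = All.tabulate a< ∷ insert-sorted qz qas sorted
      where
        a< : ∀ {b} → b ∈ insert z as → a < b
        a< b∈ with ∈-insert⁻ z as b∈
        ... | inj₁ refl  = <-connex z≢a z≮a
        ... | inj₂ b∈as = All.lookup a<as b∈as

    sort-sorted : ∀ {xs} → All Q xs → All Q (sort xs) × AllPairs _<_ (sort xs)
    sort-sorted [] = [] , []
    sort-sorted (qx ∷ qxs) with sort-sorted qxs
    ... | qs , sorted = All-insert qx qs , insert-sorted qx qs sorted

double : ℕ → ℕ
double zero    = zero
double (suc n) = suc (suc (double n))

double≡2* : ∀ n → double n ≡ 2 * n
double≡2* zero    = refl
double≡2* (suc n) = sym (trans (*-suc 2 n) (cong (suc ∘ suc) (sym (double≡2* n))))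

double-mono-≤ : ∀ {m n} → m ≤ n → double m ≤ double n
double-mono-≤ z≤n       = z≤n
double-mono-≤ (s≤s m≤n) = s≤s (s≤s (double-mono-≤ m≤n))

<2*⇒<double : ∀ {i k m} → k ≤ m → i < 2 * k → i < double m
<2*⇒<double {i} {k} k≤m i<2k = ≤-trans (subst (i <_) (sym (double≡2* k)) i<2k) (double-mono-≤ k≤m)

double-cancel-< : ∀ {a b} → double a < double b → a < b
double-cancel-< {zero}  {suc b} _                 = s≤s z≤n
double-cancel-< {suc a} {suc b} (s≤s (s≤s 2a<2b)) = s≤s (double-cancel-< 2a<2b)

double<1+double⇒≤ : ∀ {a b} → double a < suc (double b) → a ≤ b
double<1+double⇒≤ {zero}          _                 = z≤n
double<1+double⇒≤ {suc a} {suc b} (s≤s (s≤s 2a≤2b)) = s≤s (double<1+double⇒≤ 2a≤2b)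

1+double<double⇒< : ∀ {a b} → suc (double a) < double b → a < b
1+double<double⇒< {zero}  {suc b} _                   = s≤s z≤n
1+double<double⇒< {suc a} {suc b} (s≤s (s≤s 2a+1<2b)) = s≤s (1+double<double⇒< 2a+1<2b)

double-injective : ∀ {a b} → double a ≡ double b → a ≡ b
double-injective {zero}  {zero}  _     = refl
double-injective {suc a} {suc b} 2a≡2b = cong suc (double-injective (suc-injective (suc-injective 2a≡2b)))

1+double≢double : ∀ a b → suc (double a) ≢ double b
1+double≢double zero    (suc b) ()
1+double≢double (suc a) (suc b) eq = 1+double≢double a b (suc-injective (suc-injective eq))

module Arcs (T : Tournament) where

  V : Set
  V = Fin (n T)

  infix 4 _⟶_ _⟶?_
  _⟶_ : V → V → Set
  u ⟶ v = Arc T u v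

  _⟶?_ : ∀ u v → Dec (u ⟶ v)
  u ⟶? v = adj T u v ≟ᵇ true

  ⟶-irrefl : ∀ {u} → ¬ u ⟶ u
  ⟶-irrefl {u} u⟶u with () ← trans (sym u⟶u) (irrefl T u)

  ⟶⇒≢ : ∀ {u v} → u ⟶ v → u ≢ v
  ⟶⇒≢ u⟶v refl = ⟶-irrefl u⟶v

  ⟶-asym : ∀ {u v} → u ⟶ v → ¬ v ⟶ u
  ⟶-asym {u} {v} u⟶v v⟶u with () ← trans (sym v⟶u) (trans (tourn T u v (⟶⇒≢ u⟶v)) (cong not u⟶v))

  ¬⟶⇒⟵ : ∀ {u v} → u ≢ v → ¬ u ⟶ v → v ⟶ u
  ¬⟶⇒⟵ {u} {v} u≢v u↛v with adj T u v in uv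
  ... | true  = contradiction refl u↛v
  ... | false = trans (tourn T u v u≢v) (cong not uv)

  ¬⟵⇒⟶ : ∀ {u v} → u ≢ v → ¬ v ⟶ u → u ⟶ v
  ¬⟵⇒⟶ {u} {v} u≢v v↛u with u ⟶? v
  ... | yes u⟶v = u⟶v
  ... | no u↛v  = contradiction (¬⟶⇒⟵ u≢v u↛v) v↛u

  Sim-sym : ∀ {u v} → Sim T u v → Sim T v u
  Sim-sym (inj₁ u≡v)        = inj₁ (sym u≡v)
  Sim-sym (inj₂ (inj₁ u↷v)) = inj₂ (inj₂ u↷v)
  Sim-sym (inj₂ (inj₂ v↷u)) = inj₂ (inj₁ v↷u)

-- Triangle chains yield structures of Type 1 or 2

module TriangleChains (T : Tournament) where
  open Arcs T

  record Triangle : Set where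
    constructor triangle
    field base₀ base₁ apex : V
  open Triangle public

  Cyclic : Triangle → Set
  Cyclic t = base₀ t ⟶ base₁ t × base₁ t ⟶ apex t × apex t ⟶ base₀ t

  record _≺_ (s t : Triangle) : Set where
    field
      base₀⟶base₀      : base₀ s ⟶ base₀ t
      base₀⟶base₁      : base₀ s ⟶ base₁ t
      base₁⟶base₀      : base₁ s ⟶ base₀ t
      base₁⟶base₁      : base₁ s ⟶ base₁ t
      apex≢base₀       : apex s ≢ base₀ t
      apex≢base₁       : apex s ≢ base₁ t
      later-apex≢base₀ : apex t ≢ base₀ s
      later-apex≢base₁ : apex t ≢ base₁ s
  open _≺_ public

  TriangleChain : List Triangle → Set
  TriangleChain ts = All Cyclic ts × AllPairs _≺_ ts

  LongTriangleChain : ℕ → Set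
  LongTriangleChain K = Σ (List Triangle) λ ts → K ≤ length ts × TriangleChain ts

  TriangleChain-resp-⊆ : ∀ {ss ts} → ss ⊆ ts → TriangleChain ts → TriangleChain ss
  TriangleChain-resp-⊆ σ (cyc , ord) = All-resp-⊆ σ cyc , AllPairs-resp-⊆ σ ord

  -- d is the junk value of both sequences past their end.
  module Sequences (d : V) where

    bases : List Triangle → ℕ → V
    bases []       _             = d
    bases (t ∷ ts) zero          = base₀ t
    bases (t ∷ ts) (suc zero)    = base₁ t
    bases (t ∷ ts) (suc (suc i)) = bases ts i

    apexes : List Triangle → ℕ → V
    apexes ts = nth d (map apex ts)

    IsBaseOf : V → Triangle → Set
    IsBaseOf x t = x ≡ base₀ t ⊎ x ≡ base₁ t

    bases-isBase : ∀ ts {i} → i < double (length ts) → Any (IsBaseOf (bases ts i)) ts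
    bases-isBase (t ∷ ts) {zero}        _               = here (inj₁ refl)
    bases-isBase (t ∷ ts) {suc zero}    _               = here (inj₂ refl)
    bases-isBase (t ∷ ts) {suc (suc i)} (s≤s (s≤s i<n)) = there (bases-isBase ts i<n)

    apexes-isApex : ∀ ts {i} → i < length ts → Any (λ t → apexes ts i ≡ apex t) ts
    apexes-isApex (t ∷ ts) {zero}  _         = here refl
    apexes-isApex (t ∷ ts) {suc i} (s≤s i<n) = there (apexes-isApex ts i<n)

    bases-at : ∀ ts {i} → i < length ts → Σ Triangle λ t → Any (t ≡_) ts ×
               bases ts (double i) ≡ base₀ t × bases ts (suc (double i)) ≡ base₁ t × apexes ts i ≡ apex t
    bases-at (t ∷ ts) {zero}  _ = t , here refl , refl , refl , refl
    bases-at (t ∷ ts) {suc i} (s≤s i<n) with bases-at ts i<n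
    ... | s , s∈ts , eqs = s , there s∈ts , eqs

    base≢apex : ∀ {t x} → Cyclic t × IsBaseOf x t → x ≢ apex t
    base≢apex ((_ , _ , a⟶b₀) , inj₁ refl) = ≢-sym (⟶⇒≢ a⟶b₀)
    base≢apex ((_ , b₁⟶a , _) , inj₂ refl) = ⟶⇒≢ b₁⟶a

    ⟶laterBase : ∀ {t s x} → t ≺ s × IsBaseOf x s → base₀ t ⟶ x × base₁ t ⟶ x × apex t ≢ x
    ⟶laterBase (t≺s , inj₁ refl) = base₀⟶base₀ t≺s , base₁⟶base₀ t≺s , apex≢base₀ t≺s
    ⟶laterBase (t≺s , inj₂ refl) = base₀⟶base₁ t≺s , base₁⟶base₁ t≺s , apex≢base₁ t≺s

    ≢laterApex : ∀ {t s x} → t ≺ s × x ≡ apex s → base₀ t ≢ x × base₁ t ≢ x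
    ≢laterApex (t≺s , refl) = ≢-sym (later-apex≢base₀ t≺s) , ≢-sym (later-apex≢base₁ t≺s)

    bases-increasing : ∀ {ts} → TriangleChain ts →
                       ∀ {i j} → i < j → j < double (length ts) → bases ts i ⟶ bases ts j
    bases-increasing {t ∷ ts} (t-cyc ∷ _ , _)    {zero}     {suc zero}    _ _ = proj₁ t-cyc
    bases-increasing {t ∷ ts} (_ ∷ _ , t≺ts ∷ _) {zero}     {suc (suc j)} _ (s≤s (s≤s j<n)) =
      proj₁ (⟶laterBase (All.lookupAny t≺ts (bases-isBase ts j<n)))
    bases-increasing {t ∷ ts} (_ ∷ _ , t≺ts ∷ _) {suc zero} {suc (suc j)} _ (s≤s (s≤s j<n)) =
      proj₁ (proj₂ (⟶laterBase (All.lookupAny t≺ts (bases-isBase ts j<n))))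
    bases-increasing {t ∷ ts} _ {suc zero} {suc zero} (s≤s ()) _
    bases-increasing {t ∷ ts} (_ ∷ cyc , _ ∷ ord) {suc (suc i)} {suc (suc j)} (s≤s (s≤s i<j)) (s≤s (s≤s j<n)) =
      bases-increasing (cyc , ord) i<j j<n

    bases≢apexes : ∀ {ts} → TriangleChain ts →
                   ∀ {i j} → i < double (length ts) → j < length ts → bases ts i ≢ apexes ts j
    bases≢apexes {t ∷ ts} (t-cyc ∷ _ , _) {zero}     {zero} _ _ = base≢apex (t-cyc , inj₁ refl)
    bases≢apexes {t ∷ ts} (t-cyc ∷ _ , _) {suc zero} {zero} _ _ = base≢apex (t-cyc , inj₂ refl)
    bases≢apexes {t ∷ ts} (_ ∷ _ , t≺ts ∷ _) {zero}     {suc j} _ (s≤s j<n) =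
      proj₁ (≢laterApex (All.lookupAny t≺ts (apexes-isApex ts j<n)))
    bases≢apexes {t ∷ ts} (_ ∷ _ , t≺ts ∷ _) {suc zero} {suc j} _ (s≤s j<n) =
      proj₂ (≢laterApex (All.lookupAny t≺ts (apexes-isApex ts j<n)))
    bases≢apexes {t ∷ ts} (_ ∷ _ , t≺ts ∷ _) {suc (suc i)} {zero} (s≤s (s≤s i<n)) _ =
      ≢-sym (proj₂ (proj₂ (⟶laterBase (All.lookupAny t≺ts (bases-isBase ts i<n)))))
    bases≢apexes {t ∷ ts} (_ ∷ cyc , _ ∷ ord) {suc (suc i)} {suc j} (s≤s (s≤s i<n)) (s≤s j<n) =
      bases≢apexes (cyc , ord) i<n j<n

    alternation : ∀ {ts y} → TriangleChain ts → All (λ t → apex t ≡ y) ts →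
                  ∀ {i} → suc i < double (length ts) → (y ⟶ bases ts i ⇔ bases ts (suc i) ⟶ y)
    alternation {t ∷ ts} ((_ , b₁⟶a , a⟶b₀) ∷ _ , _) (refl ∷ _) {zero} _ =
      mk⇔ (λ _ → b₁⟶a) (λ _ → a⟶b₀)
    alternation {t ∷ s ∷ ts} ((_ , b₁⟶a , _) ∷ (_ , _ , a′⟶b₀′) ∷ _ , _) (refl ∷ a′≡a ∷ _) {suc zero} _ =
      mk⇔ (λ a⟶b₁ → contradiction a⟶b₁ (⟶-asym b₁⟶a))
          (λ b₀′⟶a → contradiction (subst (_⟶ base₀ s) a′≡a a′⟶b₀′) (⟶-asym b₀′⟶a))
    alternation {t ∷ ts} (_ ∷ cyc , _ ∷ ord) (_ ∷ common) {suc (suc i)} (s≤s (s≤s i<n)) =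
      alternation (cyc , ord) common i<n

    type1 : ∀ k {ts y} → TriangleChain ts → All (λ t → apex t ≡ y) ts → k ≤ length ts → Type1 T k
    type1 k {ts} {y} chain@(cyc , _) common k≤n =
      bases ts , y , ordered⇒distinct ⟶⇒≢ (bases ts) (2 * k) increasing , bases≢y ,
      (λ i j → increasing) , (λ i 1+i<2k → alternation chain common (<2*⇒<double k≤n 1+i<2k))
      where
        increasing : ∀ {i j} → i < j → j < 2 * k → bases ts i ⟶ bases ts j
        increasing i<j j<2k = bases-increasing chain i<j (<2*⇒<double k≤n j<2k)

        bases≢y : ∀ i → i < 2 * k → bases ts i ≢ y
        bases≢y i i<2k with All.lookupAny (All.zip (cyc , common)) (bases-isBase ts (<2*⇒<double k≤n i<2k))
        ... | (t-cyc , refl) , isBase = base≢apex (t-cyc , isBase)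

    type2 : ∀ k {ts} → TriangleChain ts → AllPairs (λ s t → apex s ≢ apex t) ts → k ≤ length ts →
            Type2 T k
    type2 k {ts} chain@(cyc , _) apexes-distinct k≤n =
      bases ts , apexes ts , ordered⇒distinct ⟶⇒≢ (bases ts) (2 * k) increasing ,
      ordered⇒distinct id (apexes ts) k apexes-≢ ,
      (λ i j i<2k j<k → bases≢apexes chain (<2*⇒<double k≤n i<2k) (≤-trans j<k k≤n)) ,
      (λ i j → increasing) , flanks
      where
        increasing : ∀ {i j} → i < j → j < 2 * k → bases ts i ⟶ bases ts j
        increasing i<j j<2k = bases-increasing chain i<j (<2*⇒<double k≤n j<2k)

        apexes-≢ : ∀ {i j} → i < j → j < k → apexes ts i ≢ apexes ts j
        apexes-≢ i<j j<k = nth-AllPairs d (AllPairs.map⁺ apexes-distinct) i<j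
                             (subst (_ <_) (sym (length-map apex ts)) (≤-trans j<k k≤n))

        flanks : ∀ i → i < k → bases ts (suc (2 * i)) ⟶ apexes ts i × apexes ts i ⟶ bases ts (2 * i)
        flanks i i<k rewrite sym (double≡2* i) with bases-at ts (≤-trans i<k k≤n)
        ... | t , t∈ts , b₀≡ , b₁≡ , a≡ rewrite b₀≡ | b₁≡ | a≡ = proj₂ (All.lookup cyc t∈ts)

    type1⊎type2 : ∀ k → LongTriangleChain (k * k) → Type1 T k ⊎ Type2 T k
    type1⊎type2 zero    _ = inj₁ (type1 0 {y = d} ([] , []) [] z≤n)
    type1⊎type2 (suc k) (ts , big , chain) with constantKey⊎distinctKeys apex Fin._≟_ k (suc k) ts big
    ... | inj₁ (ss , σ , len , y , common) = inj₁ (type1 (suc k) (TriangleChain-resp-⊆ σ chain) common len)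
    ... | inj₂ (ss , σ , len , distinct)   = inj₂ (type2 (suc k) (TriangleChain-resp-⊆ σ chain) distinct len)

-- Obstructions to u ↷ v

module Homogeneity (T : Tournament) where
  open Arcs T

  module _ (u v : V) where

    Between : V → Set
    Between z = u ⟶ z × z ⟶ v

    CyclicBetween : Set
    CyclicBetween = Σ V λ a → Σ V λ b → Σ V λ c →
      Between a × Between b × Between c × a ⟶ b × b ⟶ c × c ⟶ a

    SplitByDominator : Set
    SplitByDominator = Σ V λ s → Σ V λ x → Between s × x ⟶ u × x ⟶ v × s ⟶ x

    SplitByDominated : Set
    SplitByDominated = Σ V λ s → Σ V λ x → Between s × u ⟶ x × v ⟶ x × x ⟶ s

    Obstruction : Set
    Obstruction = CyclicBetween ⊎ SplitByDominator ⊎ SplitByDominated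

    Reversal : Set
    Reversal = Σ V λ y → v ⟶ y × y ⟶ u

  between? : ∀ u v z → Dec (Between u v z)
  between? u v z = u ⟶? z ×-dec z ⟶? v

  obstruction? : ∀ u v → Dec (Obstruction u v)
  obstruction? u v =
    (Fin.any? λ a → Fin.any? λ b → Fin.any? λ c →
       between? u v a ×-dec between? u v b ×-dec between? u v c ×-dec a ⟶? b ×-dec b ⟶? c ×-dec c ⟶? a)
    ⊎-dec (Fin.any? λ s → Fin.any? λ x → between? u v s ×-dec x ⟶? u ×-dec x ⟶? v ×-dec s ⟶? x)
    ⊎-dec (Fin.any? λ s → Fin.any? λ x → between? u v s ×-dec u ⟶? x ×-dec v ⟶? x ×-dec x ⟶? s)

  module _ {u v : V} (u⟶v : u ⟶ v) (noReversal : ¬ Reversal u v) (noObstruction : ¬ Obstruction u v) where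

    private
      acyclic : ∀ {a b c} → Between u v a → Between u v b → Between u v c → a ⟶ b → b ⟶ c → ¬ c ⟶ a
      acyclic ba bb bc a⟶b b⟶c c⟶a = noObstruction (inj₁ (_ , _ , _ , ba , bb , bc , a⟶b , b⟶c , c⟶a))

      open InsertionSort Fin._≟_ _⟶?_

      candidates : List V
      candidates = filter (between? u v) (allFin (n T))

      ws : List V
      ws = sort candidates

      ws-sorted : All (Between u v) ws × AllPairs _⟶_ ws
      ws-sorted = sort-sorted (Between u v) ⟶-asym ¬⟶⇒⟵ acyclic (all-filter (between? u v) (allFin (n T)))

      w : Fin (length ws) → V
      w = lookup ws

      ws-between : ∀ i → Between u v (w i)
      ws-between i = All.lookup (proj₁ ws-sorted) (∈-lookup i)

      InC : V → Set
      InC x = x ≡ u ⊎ x ≡ v ⊎ ∃ λ i → x ≡ w i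

      between⇒InC : ∀ {x} → Between u v x → InC x
      between⇒InC {x} bx = inj₂ (inj₂ (index x∈ws , lookup-index x∈ws))
        where
          x∈ws : x ∈ ws
          x∈ws = ∈-sort candidates (∈-filter⁺ (between? u v) (∈-allFin x) bx)

      module Outside {x} (x∉C : ¬ InC x) where

        x⟶u⇒x⟶v : x ⟶ u → x ⟶ v
        x⟶u⇒x⟶v x⟶u = ¬⟵⇒⟶ (λ x≡v → x∉C (inj₂ (inj₁ x≡v))) λ v⟶x → noReversal (x , v⟶x , x⟶u)

        x⟶v⇒x⟶u : x ⟶ v → x ⟶ u
        x⟶v⇒x⟶u x⟶v = ¬⟵⇒⟶ (λ x≡u → x∉C (inj₁ x≡u)) λ u⟶x → x∉C (between⇒InC (u⟶x , x⟶v))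

        x⟶u⇒x⟶w : ∀ i → x ⟶ u → x ⟶ w i
        x⟶u⇒x⟶w i x⟶u = ¬⟵⇒⟶ (λ x≡w → x∉C (inj₂ (inj₂ (i , x≡w)))) λ w⟶x →
          noObstruction (inj₂ (inj₁ (w i , x , ws-between i , x⟶u , x⟶u⇒x⟶v x⟶u , w⟶x)))

        x⟶w⇒x⟶u : ∀ i → x ⟶ w i → x ⟶ u
        x⟶w⇒x⟶u i x⟶w = ¬⟵⇒⟶ (λ x≡u → x∉C (inj₁ x≡u)) λ u⟶x →
          noObstruction (inj₂ (inj₂ (w i , x , ws-between i , u⟶x , v⟶x u⟶x , x⟶w)))
          where
            v⟶x : u ⟶ x → v ⟶ x
            v⟶x u⟶x = ¬⟵⇒⟶ (λ v≡x → x∉C (inj₂ (inj₁ (sym v≡x)))) λ x⟶v → ⟶-asym u⟶x (x⟶v⇒x⟶u x⟶v)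

      sameSide : ∀ {x} → ¬ InC x → ∀ {y} → InC y → x ⟶ u ⇔ x ⟶ y
      sameSide x∉C (inj₁ refl)            = ⇔-id _
      sameSide x∉C (inj₂ (inj₁ refl))     = mk⇔ x⟶u⇒x⟶v x⟶v⇒x⟶u where open Outside x∉C
      sameSide x∉C (inj₂ (inj₂ (i , refl))) = mk⇔ (x⟶u⇒x⟶w i) (x⟶w⇒x⟶u i) where open Outside x∉C

    curve : Curve T u v
    curve = u⟶v , length ws , w , ws-between ,
            (λ i j → AllPairs-lookup (proj₂ ws-sorted)) ,
            λ x x∉C y z y∈C z∈C → sameSide x∉C z∈C ⇔-∘ ⇔-sym (sameSide x∉C y∈C)

  -- Without an obstruction the vertices between u and v are transitively ordered, and every
  -- other vertex sees u, v and all of them from the same side: u ↷ v.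
  obstruction : ∀ {u v} → u ⟶ v → ¬ Sim T u v → ¬ Reversal u v → Obstruction u v
  obstruction {u} {v} u⟶v u≁v noReversal =
    decidable-stable (obstruction? u v) λ noObstruction → u≁v (inj₂ (inj₁ (curve u⟶v noReversal noObstruction)))

-- Long chains and their reversals

module NonSimilarChains (T : Tournament) where
  open Arcs T
  open Homogeneity T

  _⟶≁_ : V → V → Set
  a ⟶≁ b = a ⟶ b × ¬ Sim T a b

  nonSimilarChain : ∀ {m} (r : Fin m → V) → (∀ i j → i ≢ j → ¬ Sim T (r i) (r j)) →
                    ∀ N → ramseyNumber N N ≤ m → PairwiseList _⟶≁_ N
  nonSimilarChain r r-distinct N big
    with ramsey-refine _⟶?_ N N (subst (_ ≤_) (sym (length-tabulate r)) big)
           (AllPairs.tabulate⁺ {f = r} λ {i} {j} → r-distinct i j)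
  ... | inj₁ (ys , len , forward)  = ys , len , AllPairs.map swap forward
  ... | inj₂ (ys , len , backward) =
        reverse ys , subst (N ≤_) (sym (length-reverse ys)) len , AllPairs-reverse (AllPairs.map flip⟶≁ backward)
    where
      flip⟶≁ : ∀ {a b} → ¬ Sim T a b × ¬ a ⟶ b → b ⟶≁ a
      flip⟶≁ (a≁b , a↛b) = ¬⟶⇒⟵ (λ a≡b → a≁b (inj₁ a≡b)) a↛b , λ b∼a → a≁b (Sim-sym b∼a)

module ReversalScan (T : Tournament) where
  open Arcs T
  open Homogeneity T
  open NonSimilarChains T
  open TriangleChains T

  module _ (c : ℕ → V) (N : ℕ) (chain : ∀ {a b} → a < b → b < N → c a ⟶≁ c b) where

    ReversalAt : ℕ → Set
    ReversalAt i = Reversal (c i) (c (suc i))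

    reversalAt? : ∀ i → Dec (ReversalAt i)
    reversalAt? i = Fin.any? λ y → c (suc i) ⟶? y ×-dec y ⟶? c i

    IndexedReversal : Set
    IndexedReversal = Σ ℕ λ i → suc i < N × ReversalAt i

    start : IndexedReversal → ℕ
    start = proj₁

    triangleAt : IndexedReversal → Triangle
    triangleAt (i , _ , y , _) = triangle (c i) (c (suc i)) y

    reversal-offChain : ∀ ((i , _ , y , _) : IndexedReversal) → ∀ {m} → m < N → y ≢ c m
    reversal-offChain (i , 1+i<N , y , c₁⟶y , y⟶c₀) {m} m<N refl with <-cmp m (suc i)
    ... | tri< m<1+i _ _ = ⟶-asym (proj₁ (chain m<1+i 1+i<N)) c₁⟶y
    ... | tri≈ _ refl _  = ⟶-irrefl c₁⟶y
    ... | tri> _ _ 1+i<m = ⟶-asym (proj₁ (chain (<-trans (n<1+n i) 1+i<m) m<N)) y⟶c₀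

    Spaced : IndexedReversal → IndexedReversal → Set
    Spaced r s = suc (start r) < start s

    triangleAt-cyclic : ∀ r → Cyclic (triangleAt r)
    triangleAt-cyclic (i , 1+i<N , _ , c₁⟶y , y⟶c₀) = proj₁ (chain (n<1+n i) 1+i<N) , c₁⟶y , y⟶c₀

    triangleAt-≺ : ∀ {r s} → Spaced r s → triangleAt r ≺ triangleAt s
    triangleAt-≺ {r@(i , 1+i<N , _)} {s@(j , 1+j<N , _)} 1+i<j = record
      { base₀⟶base₀      = proj₁ (chain (<-trans (n<1+n i) 1+i<j) j<N)
      ; base₀⟶base₁      = proj₁ (chain (<-trans (n<1+n i) (<-trans 1+i<j (n<1+n j))) 1+j<N)
      ; base₁⟶base₀      = proj₁ (chain 1+i<j j<N)
      ; base₁⟶base₁      = proj₁ (chain (<-trans 1+i<j (n<1+n j)) 1+j<N)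
      ; apex≢base₀       = reversal-offChain r j<N
      ; apex≢base₁       = reversal-offChain r 1+j<N
      ; later-apex≢base₀ = reversal-offChain s (<-trans (n<1+n i) 1+i<N)
      ; later-apex≢base₁ = reversal-offChain s 1+i<N
      }
      where
        j<N : j < N
        j<N = <-trans (n<1+n j) 1+j<N

    spacedTriangleChain : ∀ {rs} → AllPairs Spaced rs → TriangleChain (map triangleAt rs)
    spacedTriangleChain {rs} spaced =
      All.map⁺ (All.universal triangleAt-cyclic rs) , AllPairs.map⁺ (AllPairs.map (λ {r} {s} → triangleAt-≺ {r} {s}) spaced)

    QuietWindow : ℕ → Set
    QuietWindow L = Σ ℕ λ β → β + L < N × (∀ i → i < L → ¬ ReversalAt (β + i))

    private
      budget-step : ∀ α j L K → j < L → α + suc K * (2 + L) + suc L ≤ N →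
                    2 + (α + j) + K * (2 + L) + suc L ≤ N
      budget-step α j L K j<L budget = ≤-trans (+-monoˡ-≤ (suc L) (begin
        2 + (α + j) + K * (2 + L)     ≤⟨ +-monoˡ-≤ (K * (2 + L)) (s≤s (s≤s (+-monoʳ-≤ α (<⇒≤ j<L)))) ⟩
        2 + (α + L) + K * (2 + L)     ≡⟨ cong (_+ K * (2 + L)) (sym (trans (+-suc α (suc L)) (cong suc (+-suc α L)))) ⟩
        α + (2 + L) + K * (2 + L)     ≡⟨ +-assoc α (2 + L) (K * (2 + L)) ⟩
        α + suc K * (2 + L)           ∎)) budget
        where open ≤-Reasoning

    scan : ∀ L K α → α + K * (2 + L) + suc L ≤ N →
           (Σ (List IndexedReversal) λ rs → K ≤ length rs × All (λ r → α ≤ start r) rs × AllPairs Spaced rs)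
           ⊎ QuietWindow L
    scan L zero    α _ = inj₁ ([] , z≤n , [] , [])
    scan L (suc K) α budget with Fin.any? (λ (j : Fin L) → reversalAt? (α + toℕ j))
    ... | no none = inj₂ (α , window<N , quiet)
      where
        window<N : α + L < N
        window<N = ≤-trans (≤-reflexive (sym (+-suc α L)))
                     (≤-trans (+-monoˡ-≤ (suc L) (m≤m+n α (suc K * (2 + L)))) budget)
        quiet : ∀ i → i < L → ¬ ReversalAt (α + i)
        quiet i i<L rev = none (fromℕ< i<L , subst (λ m → ReversalAt (α + m)) (sym (Fin.toℕ-fromℕ< i<L)) rev)
    ... | yes (j , rev) with scan L K (2 + (α + toℕ j)) (budget-step α (toℕ j) L K (Fin.toℕ<n j) budget)
    ...   | inj₂ quiet = inj₂ quiet
    ...   | inj₁ (rs , len , later , spaced) =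
            inj₁ ((α + toℕ j , 2+i≤N , rev) ∷ rs , s≤s len , α≤i ∷ All.map (≤-trans α≤2+i) later , later ∷ spaced)
      where
        α≤i : α ≤ α + toℕ j
        α≤i = m≤m+n α (toℕ j)
        α≤2+i : α ≤ 2 + (α + toℕ j)
        α≤2+i = ≤-trans α≤i (m≤n+m _ 2)
        2+i≤N : 2 + (α + toℕ j) ≤ N
        2+i≤N = ≤-trans (≤-trans (m≤m+n _ (K * (2 + L))) (m≤m+n _ (suc L)))
                  (budget-step α (toℕ j) L K (Fin.toℕ<n j) budget)

    reversalChain⊎quietWindow : ∀ L K → K * (2 + L) + suc L ≤ N → LongTriangleChain K ⊎ QuietWindow L
    reversalChain⊎quietWindow L K budget with scan L K 0 budget
    ... | inj₁ (rs , len , _ , spaced) =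
          inj₁ (map triangleAt rs , subst (K ≤_) (sym (length-map triangleAt rs)) len , spacedTriangleChain spaced)
    ... | inj₂ quiet = inj₂ quiet

-- Quiet windows

module QuietSegments (T : Tournament) where
  open Arcs T
  open Homogeneity T
  open NonSimilarChains T
  open TriangleChains T

  module _ (seg : ℕ → V) (L : ℕ) (increasing : ∀ {a b} → a < b → b ≤ L → seg a ⟶≁ seg b)
           (quiet : ∀ {i} → i < L → ¬ Reversal (seg i) (seg (suc i))) where

    seg-⟶ : ∀ {a b} → a < b → b ≤ L → seg a ⟶ seg b
    seg-⟶ a<b b≤L = proj₁ (increasing a<b b≤L)

    ⟶seg-step : ∀ {z m} → m < L → z ⟶ seg m → z ⟶ seg (suc m)
    ⟶seg-step {m = m} m<L z⟶ = ¬⟵⇒⟶ (λ { refl → ⟶-asym z⟶ (seg-⟶ (n<1+n m) m<L) })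
                                      (λ ⟶z → quiet m<L (_ , ⟶z , z⟶))

    seg⟶-step : ∀ {z m} → m < L → seg (suc m) ⟶ z → seg m ⟶ z
    seg⟶-step {m = m} m<L ⟶z = ¬⟵⇒⟶ (λ { refl → ⟶-asym ⟶z (seg-⟶ (n<1+n m) m<L) })
                                      (λ z⟶ → quiet m<L (_ , ⟶z , z⟶))

    ⟶seg-upward : ∀ {z i m} → z ⟶ seg i → i ≤ m → m ≤ L → z ⟶ seg m
    ⟶seg-upward z⟶ i≤m m≤L with m≤n⇒m<n∨m≡n i≤m
    ... | inj₂ refl = z⟶
    ⟶seg-upward {m = suc m} z⟶ _ m<L | inj₁ (s≤s i≤m) = ⟶seg-step m<L (⟶seg-upward z⟶ i≤m (<⇒≤ m<L))

    seg⟶-downward : ∀ {z i m} → seg i ⟶ z → m ≤ i → i ≤ L → seg m ⟶ z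
    seg⟶-downward ⟶z m≤i i≤L with m≤n⇒m<n∨m≡n m≤i
    ... | inj₂ refl = ⟶z
    seg⟶-downward {i = suc i} ⟶z _ i<L | inj₁ (s≤s m≤i) = seg⟶-downward (seg⟶-step i<L ⟶z) m≤i (<⇒≤ i<L)

    data Level (z : V) : ℕ → Set where
      on      : ∀ m → m ≤ L → z ≡ seg m → Level z (double m)
      between : ∀ i → i < L → seg i ⟶ z → z ⟶ seg (suc i) → Level z (suc (double i))

    level⟶seg : ∀ {z ℓ m} → Level z ℓ → m ≤ L → ℓ < double m → z ⟶ seg m
    level⟶seg (on _ _ refl)      m≤L ℓ<2m = seg-⟶ (double-cancel-< ℓ<2m) m≤L
    level⟶seg (between _ _ _ z⟶) m≤L ℓ<2m = ⟶seg-upward z⟶ (1+double<double⇒< ℓ<2m) m≤L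

    seg⟶level : ∀ {z ℓ m} → m ≤ L → double m < ℓ → Level z ℓ → seg m ⟶ z
    seg⟶level _ 2m<ℓ (on _ m′≤L refl)     = seg-⟶ (double-cancel-< 2m<ℓ) m′≤L
    seg⟶level _ 2m<ℓ (between _ i<L ⟶z _) = seg⟶-downward ⟶z (double<1+double⇒≤ 2m<ℓ) (<⇒≤ i<L)

    Level-even : ∀ {z ℓ m} → Level z ℓ → ℓ ≡ double m → z ≡ seg m
    Level-even (on _ _ z≡)       ℓ≡2m rewrite double-injective ℓ≡2m = z≡
    Level-even (between i _ _ _) ℓ≡2m = contradiction ℓ≡2m (1+double≢double i _)

    Level-< : ∀ {z ℓ ℓ′} → Level z ℓ → Level z ℓ′ → ¬ ℓ < ℓ′
    Level-< lz (on m m≤L refl) ℓ<2m = ⟶-irrefl (level⟶seg lz m≤L ℓ<2m)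
    Level-< lz (between i i<L ⟶z _) (s≤s ℓ≤2i) with m≤n⇒m<n∨m≡n ℓ≤2i
    ... | inj₁ ℓ<2i  = ⟶-asym (level⟶seg lz (<⇒≤ i<L) ℓ<2i) ⟶z
    ... | inj₂ ℓ≡2i = ⟶-irrefl (subst (seg i ⟶_) (Level-even lz ℓ≡2i) ⟶z)

    Level-<⇒≢ : ∀ {a b ℓ ℓ′} → Level a ℓ → Level b ℓ′ → ℓ < ℓ′ → a ≢ b
    Level-<⇒≢ la lb ℓ<ℓ′ refl = Level-< la lb ℓ<ℓ′

    record LevelIn (z : V) (i : ℕ) : Set where
      constructor levelIn
      field
        {level} : ℕ
        isLevel : Level z level
        lower   : double i ≤ level
        upper   : level ≤ double (suc i)
    open LevelIn

    ⟶seg-next⊎≡ : ∀ {z i} → LevelIn z i → i < L → z ⟶ seg (suc i) ⊎ z ≡ seg (suc i)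
    ⟶seg-next⊎≡ {i = i} (levelIn lz _ ℓ≤) i<L with _ <? double (suc i)
    ... | yes ℓ< = inj₁ (level⟶seg lz i<L ℓ<)
    ... | no ℓ≮ = inj₂ (Level-even lz (≤-antisym ℓ≤ (≮⇒≥ ℓ≮)))

    record Block (i : ℕ) : Set where
      field
        shape      : Triangle
        cyclic     : Cyclic shape
        base₀-in   : LevelIn (base₀ shape) i
        base₁-in   : LevelIn (base₁ shape) i
        -- These keep the apex off the corners of any block at distance at least two.
        apex-below : ∀ {ℓ} → Level (apex shape) ℓ → ℓ < double i →
                     base₀ shape ⟶ apex shape ⊎ base₁ shape ⟶ apex shape
        apex-above : ∀ {ℓ} → Level (apex shape) ℓ → double (suc i) < ℓ →
                     apex shape ⟶ base₀ shape ⊎ apex shape ⟶ base₁ shape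
    open Block

    block : ∀ i → i < L → Block i
    block i i<L with obstruction (seg-⟶ (n<1+n i) i<L) (proj₂ (increasing (n<1+n i) i<L)) (quiet i<L)
    ... | inj₁ (a , b , c , (⟶a , a⟶) , (⟶b , b⟶) , (⟶c , c⟶) , a⟶b , b⟶c , c⟶a) = record
      { shape      = triangle a b c
      ; cyclic     = a⟶b , b⟶c , c⟶a
      ; base₀-in   = levelIn (between i i<L ⟶a a⟶) (n≤1+n _) (n≤1+n _)
      ; base₁-in   = levelIn (between i i<L ⟶b b⟶) (n≤1+n _) (n≤1+n _)
      ; apex-below = λ lc ℓ<2i → ⊥-elim (Level-< lc (between i i<L ⟶c c⟶) (<-trans ℓ<2i (n<1+n _)))
      ; apex-above = λ lc 2i+2<ℓ → ⊥-elim (Level-< (between i i<L ⟶c c⟶) lc (<-trans (n<1+n _) 2i+2<ℓ))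
      }
    ... | inj₂ (inj₁ (s , x , (⟶s , s⟶) , x⟶u , x⟶v , s⟶x)) = record
      { shape      = triangle (seg i) s x
      ; cyclic     = ⟶s , s⟶x , x⟶u
      ; base₀-in   = levelIn (on i (<⇒≤ i<L) refl) ≤-refl (double-mono-≤ (n≤1+n i))
      ; base₁-in   = levelIn (between i i<L ⟶s s⟶) (n≤1+n _) (n≤1+n _)
      ; apex-below = λ _ _ → inj₂ s⟶x
      ; apex-above = λ lx 2i+2<ℓ → ⊥-elim (⟶-asym x⟶v (seg⟶level i<L 2i+2<ℓ lx))
      }
    ... | inj₂ (inj₂ (s , x , (⟶s , s⟶) , u⟶x , v⟶x , x⟶s)) = record
      { shape      = triangle s (seg (suc i)) x
      ; cyclic     = s⟶ , v⟶x , x⟶s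
      ; base₀-in   = levelIn (between i i<L ⟶s s⟶) (n≤1+n _) (n≤1+n _)
      ; base₁-in   = levelIn (on (suc i) i<L refl) (double-mono-≤ (n≤1+n i)) ≤-refl
      ; apex-below = λ lx ℓ<2i → ⊥-elim (⟶-asym u⟶x (level⟶seg lx (<⇒≤ i<L) ℓ<2i))
      ; apex-above = λ _ _ → inj₁ x⟶s
      }

    PlacedBlock : Set
    PlacedBlock = Σ ℕ λ i → i < L × Block i

    position : PlacedBlock → ℕ
    position = proj₁

    position<L : ∀ x → position x < L
    position<L (_ , i<L , _) = i<L

    shapeOf : PlacedBlock → Triangle
    shapeOf (_ , _ , b) = shape b

    corner₀ corner₁ : PlacedBlock → V
    corner₀ = base₀ ∘ shapeOf
    corner₁ = base₁ ∘ shapeOf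

    Levelled : (PlacedBlock → V) → Set
    Levelled e = ∀ x → LevelIn (e x) (position x)

    corner₀-levelled : Levelled corner₀
    corner₀-levelled (_ , _ , b) = base₀-in b

    corner₁-levelled : Levelled corner₁
    corner₁-levelled (_ , _ , b) = base₁-in b

    infix 4 _≪_
    record _≪_ (a b : PlacedBlock) : Set where
      constructor gap
      field 2+a≤b : suc (suc (position a)) ≤ position b

    seg-next-level : ∀ x → Level (seg (suc (position x))) (double (suc (position x)))
    seg-next-level x = on (suc (position x)) (position<L x) refl

    module _ {a b : PlacedBlock} (a≪b : a ≪ b) where

      next<double : double (suc (position a)) < double (position b)
      next<double = ≤-trans (s≤s (n≤1+n _)) (double-mono-≤ (_≪_.2+a≤b a≪b))

      level<double : ∀ {z} (za : LevelIn z (position a)) → level za < double (position b)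
      level<double za = ≤-<-trans (upper za) next<double

      next<level : ∀ {w} (wb : LevelIn w (position b)) → double (suc (position a)) < level wb
      next<level wb = <-≤-trans next<double (lower wb)

      level<next : ∀ {z} (za : LevelIn z (position a)) → level za < double (suc (position b))
      level<next za = <-trans (level<double za) (s≤s (n≤1+n _))

      ≢-later : ∀ {z w} → LevelIn z (position a) → LevelIn w (position b) → z ≢ w
      ≢-later za wb = Level-<⇒≢ (isLevel za) (isLevel wb) (<-≤-trans (level<double za) (lower wb))

      seg-next⟶ : ∀ {w} → LevelIn w (position b) → seg (suc (position a)) ⟶ w
      seg-next⟶ wb = seg⟶level (position<L a) (next<level wb) (isLevel wb)

      seg-next≢ : ∀ {w} → LevelIn w (position b) → seg (suc (position a)) ≢ w
      seg-next≢ wb = Level-<⇒≢ (seg-next-level a) (isLevel wb) (next<level wb)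

      ⟶seg-next : ∀ {z} → LevelIn z (position a) → z ⟶ seg (suc (position b))
      ⟶seg-next za = level⟶seg (isLevel za) (position<L b) (level<next za)

      ≢seg-next : ∀ {z} → LevelIn z (position a) → z ≢ seg (suc (position b))
      ≢seg-next za = Level-<⇒≢ (isLevel za) (seg-next-level b) (level<next za)

    apex≢later : ∀ {a z ℓ} → Level z ℓ → double (suc (position a)) < ℓ →
                 corner₀ a ⟶ z → corner₁ a ⟶ z → apex (shapeOf a) ≢ z
    apex≢later {_ , _ , B} lz 2i+2<ℓ c₀⟶z c₁⟶z refl with apex-above B lz 2i+2<ℓ
    ... | inj₁ z⟶c₀ = ⟶-asym c₀⟶z z⟶c₀
    ... | inj₂ z⟶c₁ = ⟶-asym c₁⟶z z⟶c₁

    apex≢earlier : ∀ {b z ℓ} → Level z ℓ → ℓ < double (position b) →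
                   z ⟶ corner₀ b → z ⟶ corner₁ b → apex (shapeOf b) ≢ z
    apex≢earlier {_ , _ , B} lz ℓ<2i z⟶c₀ z⟶c₁ refl with apex-below B lz ℓ<2i
    ... | inj₁ c₀⟶z = ⟶-asym c₀⟶z z⟶c₀
    ... | inj₂ c₁⟶z = ⟶-asym c₁⟶z z⟶c₁

    Forward : PlacedBlock → PlacedBlock → Set
    Forward a b = a ≪ b × corner₀ a ⟶ corner₀ b × corner₀ a ⟶ corner₁ b
                        × corner₁ a ⟶ corner₀ b × corner₁ a ⟶ corner₁ b

    forward-≺ : ∀ {a b} → Forward a b → shapeOf a ≺ shapeOf b
    forward-≺ {a} {b} (a≪b , c₀c₀ , c₀c₁ , c₁c₀ , c₁c₁) = record
      { base₀⟶base₀      = c₀c₀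
      ; base₀⟶base₁      = c₀c₁
      ; base₁⟶base₀      = c₁c₀
      ; base₁⟶base₁      = c₁c₁
      ; apex≢base₀       = apex≢later {a} (isLevel b₀) (next<level a≪b b₀) c₀c₀ c₁c₀
      ; apex≢base₁       = apex≢later {a} (isLevel b₁) (next<level a≪b b₁) c₀c₁ c₁c₁
      ; later-apex≢base₀ = apex≢earlier {b} (isLevel a₀) (level<double a≪b a₀) c₀c₀ c₀c₁
      ; later-apex≢base₁ = apex≢earlier {b} (isLevel a₁) (level<double a≪b a₁) c₁c₀ c₁c₁
      }
      where
        a₀ : LevelIn (corner₀ a) (position a)
        a₀ = corner₀-levelled a
        a₁ : LevelIn (corner₁ a) (position a)
        a₁ = corner₁-levelled a
        b₀ : LevelIn (corner₀ b) (position b)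
        b₀ = corner₀-levelled b
        b₁ : LevelIn (corner₁ b) (position b)
        b₁ = corner₁-levelled b

    forwardChain : ∀ {xs} → AllPairs Forward xs → TriangleChain (map shapeOf xs)
    forwardChain {xs} forward =
      All.map⁺ (All.universal (λ { (_ , _ , B) → cyclic B }) xs) ,
      AllPairs.map⁺ (AllPairs.map (λ {a} {b} → forward-≺ {a} {b}) forward)

    ⟶seg-next-unless : ∀ {z w x} → LevelIn z (position x) → w ⟶ z → seg (suc (position x)) ⟶ w →
                       z ⟶ seg (suc (position x))
    ⟶seg-next-unless {x = x} zx w⟶z s⟶w with ⟶seg-next⊎≡ zx (position<L x)
    ... | inj₁ z⟶s = z⟶s
    ... | inj₂ refl = contradiction s⟶w (⟶-asym w⟶z)

    Descending : (PlacedBlock → V) → PlacedBlock → PlacedBlock → Set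
    Descending e a b = b ≪ a × e a ⟶ e b

    -- The arc e a ⟶ e b runs against the window, so the window vertex between the two
    -- blocks closes a cyclic triangle; likewise f b ⟶ e a in crossingTriangle.
    descendingTriangle : (PlacedBlock → V) → PlacedBlock × PlacedBlock → Triangle
    descendingTriangle e (a , b) = triangle (e a) (e b) (seg (suc (position b)))

    module _ {e : PlacedBlock → V} (levelled : Levelled e) where

      descending-cyclic : ∀ {a b} → Descending e a b → Cyclic (descendingTriangle e (a , b))
      descending-cyclic {a} {b} (b≪a , ea⟶eb) =
        ea⟶eb , ⟶seg-next-unless {x = b} (levelled b) ea⟶eb s⟶ea , s⟶ea
        where
          s⟶ea : seg (suc (position b)) ⟶ e a
          s⟶ea = seg-next⟶ b≪a (levelled a)

      descending-≺ : ∀ {ab cd} → Across (Descending e) ab cd →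
                     descendingTriangle e ab ≺ descendingTriangle e cd
      descending-≺ {a , b} {c , d} ((_ , ea⟶ec) , (d≪a , ea⟶ed) , (c≪b , eb⟶ec) , (d≪b , eb⟶ed)) = record
        { base₀⟶base₀      = ea⟶ec
        ; base₀⟶base₁      = ea⟶ed
        ; base₁⟶base₀      = eb⟶ec
        ; base₁⟶base₁      = eb⟶ed
        ; apex≢base₀       = ≢-sym (≢seg-next c≪b (levelled c))
        ; apex≢base₁       = ≢-sym (≢seg-next d≪b (levelled d))
        ; later-apex≢base₀ = seg-next≢ d≪a (levelled a)
        ; later-apex≢base₁ = seg-next≢ d≪b (levelled b)
        }

      descendingChain : ∀ {xs} → AllPairs (Descending e) xs →
                        TriangleChain (map (descendingTriangle e) (pairs xs))
      descendingChain descending =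
        All.map⁺ (All.map descending-cyclic (All-pairs descending)) ,
        AllPairs.map⁺ (AllPairs.map descending-≺ (AllPairs-pairs descending))

    Crossing : (PlacedBlock → V) → (PlacedBlock → V) → PlacedBlock → PlacedBlock → Set
    Crossing e f a b = a ≪ b × e a ⟶ e b × f b ⟶ e a

    crossingTriangle : (PlacedBlock → V) → (PlacedBlock → V) → PlacedBlock × PlacedBlock → Triangle
    crossingTriangle e f (a , b) = triangle (e a) (seg (suc (position a))) (f b)

    module _ {e f : PlacedBlock → V} (e-levelled : Levelled e) (f-levelled : Levelled f) where

      crossing-cyclic : ∀ {a b} → Crossing e f a b → Cyclic (crossingTriangle e f (a , b))
      crossing-cyclic {a} {b} (a≪b , _ , fb⟶ea) =
        ⟶seg-next-unless {x = a} (e-levelled a) fb⟶ea s⟶fb , s⟶fb , fb⟶ea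
        where
          s⟶fb : seg (suc (position a)) ⟶ f b
          s⟶fb = seg-next⟶ a≪b (f-levelled b)

      crossing-≺ : ∀ {ab cd} → Across (Crossing e f) ab cd →
                   crossingTriangle e f ab ≺ crossingTriangle e f cd
      crossing-≺ {a , b} {c , d} ((a≪c , ea⟶ec , _) , (a≪d , _) , (b≪c , _) , _) = record
        { base₀⟶base₀      = ea⟶ec
        ; base₀⟶base₁      = ⟶seg-next a≪c (e-levelled a)
        ; base₁⟶base₀      = seg-next⟶ a≪c (e-levelled c)
        ; base₁⟶base₁      = seg-⟶ (s≤s (≤-trans (n≤1+n _) (_≪_.2+a≤b a≪c))) (position<L c)
        ; apex≢base₀       = ≢-later b≪c (f-levelled b) (e-levelled c)
        ; apex≢base₁       = ≢seg-next b≪c (f-levelled b)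
        ; later-apex≢base₀ = ≢-sym (≢-later a≪d (e-levelled a) (f-levelled d))
        ; later-apex≢base₁ = ≢-sym (seg-next≢ a≪d (f-levelled d))
        }

      crossingChain : ∀ {xs} → AllPairs (Crossing e f) xs →
                      TriangleChain (map (crossingTriangle e f) (pairs xs))
      crossingChain crossing =
        All.map⁺ (All.map crossing-cyclic (All-pairs crossing)) ,
        AllPairs.map⁺ (AllPairs.map crossing-≺ (AllPairs-pairs crossing))

    evenBlocks : ∀ h → double h ≤ L → List PlacedBlock
    evenBlocks h 2h≤L = tabulate λ (t : Fin h) →
      let 2t<L = ≤-trans (n≤1+n _) (≤-trans (double-mono-≤ (Fin.toℕ<n t)) 2h≤L)
      in double (toℕ t) , 2t<L , block (double (toℕ t)) 2t<L

    evenBlocks-≪ : ∀ h 2h≤L → AllPairs _≪_ (evenBlocks h 2h≤L)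
    evenBlocks-≪ h 2h≤L = AllPairs.tabulate⁺-< λ t<t′ → gap (double-mono-≤ t<t′)

    fromDescent : ∀ K {e} → Levelled e → PairwiseList (λ a b → a ≪ b × ¬ e a ⟶ e b) (K + K) →
                  LongTriangleChain K
    fromDescent K {e} levelled (ys , len , descent) =
      map (descendingTriangle e) (pairs (reverse ys)) ,
      subst (K ≤_) (sym (length-map _ (pairs (reverse ys))))
        (length-pairs K (reverse ys) (subst (K + K ≤_) (sym (length-reverse ys)) len)) ,
      descendingChain levelled (AllPairs-reverse (AllPairs.map flipArc descent))
      where
        flipArc : ∀ {a b} → a ≪ b × ¬ e a ⟶ e b → Descending e b a
        flipArc {a} {b} (a≪b , ea↛eb) = a≪b , ¬⟶⇒⟵ (≢-later a≪b (levelled a) (levelled b)) ea↛eb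

    fromCrossing : ∀ K {e f} → Levelled e → Levelled f →
                   PairwiseList (λ a b → (a ≪ b × e a ⟶ e b) × ¬ e a ⟶ f b) (K + K) → LongTriangleChain K
    fromCrossing K {e} {f} e-levelled f-levelled (ys , len , crossing) =
      map (crossingTriangle e f) (pairs ys) ,
      subst (K ≤_) (sym (length-map _ (pairs ys))) (length-pairs K ys len) ,
      crossingChain e-levelled f-levelled (AllPairs.map flipArc crossing)
      where
        flipArc : ∀ {a b} → (a ≪ b × e a ⟶ e b) × ¬ e a ⟶ f b → Crossing e f a b
        flipArc {a} {b} ((a≪b , ea⟶eb) , ea↛fb) =
          a≪b , ea⟶eb , ¬⟶⇒⟵ (≢-later a≪b (e-levelled a) (f-levelled b)) ea↛fb

    quietTriangleChain : ∀ K → double (ramseyTower 4 (K + K)) ≤ L → LongTriangleChain K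
    quietTriangleChain K room
      with ramsey-refine (λ a b → corner₀ a ⟶? corner₀ b) (ramseyTower 3 (K + K)) (K + K)
             (≤-reflexive (sym (length-tabulate _))) (evenBlocks-≪ _ room)
    ... | inj₂ descent₀ = fromDescent K corner₀-levelled descent₀
    ... | inj₁ (_ , len₁ , ap₁)
      with ramsey-refine (λ a b → corner₁ a ⟶? corner₁ b) (ramseyTower 2 (K + K)) (K + K) len₁ ap₁
    ...   | inj₂ (ys , len , descent₁) =
            fromDescent K corner₁-levelled (ys , len , AllPairs.map (λ ((a≪b , _) , c₁↛c₁) → a≪b , c₁↛c₁) descent₁)
    ...   | inj₁ (_ , len₂ , ap₂)
      with ramsey-refine (λ a b → corner₁ a ⟶? corner₀ b) (ramseyTower 1 (K + K)) (K + K) len₂ ap₂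
    ...     | inj₂ (ys , len , cross) = fromCrossing K corner₁-levelled corner₀-levelled
                (ys , len , AllPairs.map (λ (((a≪b , _) , c₁c₁) , c₁↛c₀) → (a≪b , c₁c₁) , c₁↛c₀) cross)
    ...     | inj₁ (_ , len₃ , ap₃)
      with ramsey-refine (λ a b → corner₀ a ⟶? corner₁ b) (K + K) (K + K) len₃ ap₃
    ...       | inj₂ (ys , len , cross) = fromCrossing K corner₀-levelled corner₁-levelled
                  (ys , len , AllPairs.map (λ ((((a≪b , c₀c₀) , _) , _) , c₀↛c₁) → (a≪b , c₀c₀) , c₀↛c₁) cross)
    ...       | inj₁ (ys , len , forward) =
                  map shapeOf ys , subst (K ≤_) (sym (length-map shapeOf ys)) (≤-trans (m≤m+n K K) len) ,
                  forwardChain (AllPairs.map (λ ((((a≪b , c₀c₀) , c₁c₁) , c₁c₀) , c₀c₁) → a≪b , c₀c₀ , c₀c₁ , c₁c₀ , c₁c₁) forward)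

-- K reversal triangles use at most K windows of 2 + L vertices and a quiet window needs L + 1
-- more; four Ramsey rounds on the L / 2 blocks at even positions of a quiet window leave K + K.
windowLength : ℕ → ℕ
windowLength K = double (ramseyTower 4 (K + K))

chainLength : ℕ → ℕ
chainLength K = K * (2 + windowLength K) + suc (windowLength K)

blocksNeeded : ℕ → ℕ
blocksNeeded k = ramseyNumber (chainLength (k * k)) (chainLength (k * k))

module _ (T : Tournament) where
  open Arcs T
  open Homogeneity T
  open NonSimilarChains T
  open TriangleChains T
  open ReversalScan T
  open QuietSegments T

  fromNonSimilarChain : ∀ k (d : V) (c : ℕ → V) →
                        (∀ {a b} → a < b → b < chainLength (k * k) → c a ⟶≁ c b) → Type1 T k ⊎ Type2 T k
  fromNonSimilarChain k d c chain
    with reversalChain⊎quietWindow c (chainLength (k * k)) chain (windowLength (k * k)) (k * k) ≤-refl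
  ... | inj₁ reversalTriangles = Sequences.type1⊎type2 d k reversalTriangles
  ... | inj₂ (β , β+L<N , quietWindow) =
        Sequences.type1⊎type2 d k (quietTriangleChain (λ m → c (β + m)) L increasing quiet (k * k) ≤-refl)
    where
      L : ℕ
      L = windowLength (k * k)
      increasing : ∀ {a b} → a < b → b ≤ L → c (β + a) ⟶≁ c (β + b)
      increasing a<b b≤L = chain (+-monoʳ-< β a<b) (≤-<-trans (+-monoʳ-≤ β b≤L) β+L<N)
      quiet : ∀ {i} → i < L → ¬ Reversal (c (β + i)) (c (β + suc i))
      quiet {i} i<L rev = quietWindow i i<L (subst (λ m → Reversal (c (β + i)) (c m)) (+-suc β i) rev)

  type1⊎type2 : ∀ k → AtLeastBlocks T (blocksNeeded k) → Type1 T k ⊎ Type2 T k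
  type1⊎type2 k (r , r-distinct) with nonSimilarChain r r-distinct (chainLength (k * k)) ≤-refl
  ... | [] , N≤0 , _ = contradiction (n≤0⇒n≡0 N≤0) (m+1+n≢0 _)
  ... | d ∷ C , N≤|C| , nonSimilar =
        fromNonSimilarChain k d (nth d (d ∷ C)) λ a<b b<N → nth-AllPairs d nonSimilar a<b (≤-trans b<N N≤|C|)

lemma6 : (P : Property) → Hereditary P → InfiniteB P →
    (k : ℕ) → Σ Tournament (λ T → P T × (Type1 T k ⊎ Type2 T k))
lemma6 P _ infinite k with infinite (blocksNeeded k)
... | T , T∈P , manyBlocks = T , T∈P , type1⊎type2 T k manyBlocks
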